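{- The permutations $3142$ and $3241$ are not DI-sortable.
   Context: The DI machine consists of two stacks in series: a decreasing stack D followed by an increasing stack I. A permutation $\pi=\pi(1)\cdots\pi(n)$ is processed from left to right, and at each step one of three moves may be made: (i) push the next unread entry of the input onto the top of D; (ii) move the top entry of D onto the top of I; (iii) move the top entry of I to the end of the output. The stacks are restricted: the entries of D must be decreasing when read from top to bottom (so an entry may be placed onto D only if it is larger than the current top entry of D, or D is empty), and the entries of I must be increasing when read from top to bottom (so an entry may be placed onto I only if it is smaller than the current top entry of I, or I is empty). A permutation $\pi$ of length $n$ is DI-sortable if some sequence of legal moves empties the input and both stacks and produces the output $12\cdots n$. -}

module Defs where

open import Data.Nat using (ℕ; suc; _<_; _>_)
open import Data.List using (List; []; _∷_; _++_; [_])
open import Data.List.Base using (upTo; map)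
open import Data.Product using (_×_; _,_)
open import Relation.Binary.Construct.Closure.ReflexiveTransitive using (Star)
open import Data.Unit using (⊤; tt)

-- A configuration of the DI machine:
--   (remaining input, stack D listed top-first, stack I listed top-first, output so far)
Config : Set
Config = List ℕ × List ℕ × List ℕ × List ℕ

-- D must be decreasing read top to bottom: a new entry x may be pushed on D
-- only if D is empty or x is larger than the current top.
CanPushD : ℕ → List ℕ → Set
CanPushD x []      = ⊤
CanPushD x (t ∷ _) = t < x

-- I must be increasing read top to bottom: a new entry x may be pushed on I
-- only if I is empty or x is smaller than the current top.
CanPushI : ℕ → List ℕ → Set
CanPushI x []      = ⊤
CanPushI x (t ∷ _) = x < t

data Step : Config → Config → Set where
  pushD : ∀ {x inp d i out} → CanPushD x d →
          Step (x ∷ inp , d , i , out) (inp , x ∷ d , i , out)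
  moveDI : ∀ {x inp d i out} → CanPushI x i →
           Step (inp , x ∷ d , i , out) (inp , d , x ∷ i , out)
  popI : ∀ {x inp d i out} →
         Step (inp , d , x ∷ i , out) (inp , d , i , out ++ [ x ])

identity : ℕ → List ℕ
identity n = map suc (upTo n)

DISortable : (n : ℕ) → List ℕ → Set
DISortable n π = Star Step (π , [] , [] , []) ([] , [] , [] , identity n)

module Submission where

-- The output of the DI machine only ever grows at its end, so a
-- run that sorts π to 1 2 ⋯ n never passes through a configuration whose
-- output is not a prefix of 1 2 ⋯ n.  Hence, to show that a configuration
-- cannot reach the sorted target it suffices to exhibit a set of "live"
-- configurations that contains it, misses the target, and is closed under
-- steps except for steps that spoil the output (the pruned invariant
-- principle `unreachable`).
--
-- For 3142 and 3241 the live sets are small (9 and 7 configurations) and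
-- share one reason for failure: the entry 3 has to wait in I for the smaller
-- entries, so the 4 read next can never pass to I and blocks D, and the last
-- entry (2, resp. 1), being smaller than 4, can never be read.  In particular
-- every live configuration still has a nonempty input, so none is the target.

open import Defs
open import Data.Nat using (ℕ; s≤s)
open import Data.List using (List; []; _∷_; _++_; [_])
open import Data.List.Properties using (++-identityʳ; ++-assoc)
open import Data.Product using (_×_; _,_; ∃)
open import Data.Sum using (_⊎_; inj₁; inj₂)
open import Relation.Nullary using (¬_)
open import Relation.Binary.PropositionalEquality using (_≡_; _≢_; refl; sym; trans; cong)
open import Relation.Binary.Construct.Closure.ReflexiveTransitive using (Star; ε; _◅_)

output : Config → List ℕ
output (_ , _ , _ , out) = out

step-extends-output : ∀ {c c'} → Step c c' → ∃ λ suffix → output c' ≡ output c ++ suffix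
step-extends-output (pushD _)      = [] , sym (++-identityʳ _)
step-extends-output (moveDI _)     = [] , sym (++-identityʳ _)
step-extends-output (popI {x = x}) = [ x ] , refl

run-extends-output : ∀ {c c'} → Star Step c c' → ∃ λ suffix → output c' ≡ output c ++ suffix
run-extends-output ε = [] , sym (++-identityʳ _)
run-extends-output {c} (s ◅ ss) with step-extends-output s | run-extends-output ss
... | xs , eq₁ | ys , eq₂ = xs ++ ys , trans eq₂ (trans (cong (_++ ys) eq₁) (++-assoc (output c) xs ys))

OutputDiverges : List ℕ → Config → Set
OutputDiverges goal c = ∀ suffix → output c ++ suffix ≢ goal

module _ (target : Config) (Live : Config → Set)
         (live-step : ∀ {c c'} → Live c → Step c c' → Live c' ⊎ OutputDiverges (output target) c')
         (target-dead : ¬ Live target) where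

  unreachable : ∀ {c} → Live c → ¬ Star Step c target
  unreachable live ε = target-dead live
  unreachable live (s ◅ ss) with live-step live s
  ... | inj₁ live' = unreachable live' ss
  ... | inj₂ diverges with run-extends-output ss
  ...   | suffix , eq = diverges suffix (sym eq)

sorted : ℕ → Config
sorted n = [] , [] , [] , identity n

-- Live configurations for π = 3142 (D and I listed top first).  3 cannot go
-- to the output before 1, so it must sit in I; then 4 is stuck on D, and 2
-- (smaller than 4) can never be read.
data Live3142 : Config → Set where
  start      : Live3142 (3 ∷ 1 ∷ 4 ∷ 2 ∷ [] , [] , [] , [])
  3inD       : Live3142 (1 ∷ 4 ∷ 2 ∷ [] , 3 ∷ [] , [] , [])
  3inI       : Live3142 (1 ∷ 4 ∷ 2 ∷ [] , [] , 3 ∷ [] , [])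
  1inD       : Live3142 (4 ∷ 2 ∷ [] , 1 ∷ [] , 3 ∷ [] , [])
  41inD      : Live3142 (2 ∷ [] , 4 ∷ 1 ∷ [] , 3 ∷ [] , [])
  13inI      : Live3142 (4 ∷ 2 ∷ [] , [] , 1 ∷ 3 ∷ [] , [])
  4inD-13inI : Live3142 (2 ∷ [] , 4 ∷ [] , 1 ∷ 3 ∷ [] , [])
  1out       : Live3142 (4 ∷ 2 ∷ [] , [] , 3 ∷ [] , 1 ∷ [])
  4inD-1out  : Live3142 (2 ∷ [] , 4 ∷ [] , 3 ∷ [] , 1 ∷ [])

live3142-step : ∀ {c c'} → Live3142 c → Step c c' → Live3142 c' ⊎ OutputDiverges (identity 4) c'
live3142-step start      (pushD _)                      = inj₁ 3inD
live3142-step 3inD       (pushD (s≤s ()))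
live3142-step 3inD       (moveDI _)                     = inj₁ 3inI
live3142-step 3inI       (pushD _)                      = inj₁ 1inD
live3142-step 3inI       popI                           = inj₂ λ _ ()
live3142-step 1inD       (pushD _)                      = inj₁ 41inD
live3142-step 1inD       (moveDI _)                     = inj₁ 13inI
live3142-step 1inD       popI                           = inj₂ λ _ ()
live3142-step 41inD      (pushD (s≤s (s≤s ())))
live3142-step 41inD      (moveDI (s≤s (s≤s (s≤s ()))))
live3142-step 41inD      popI                           = inj₂ λ _ ()
live3142-step 13inI      (pushD _)                      = inj₁ 4inD-13inI
live3142-step 13inI      popI                           = inj₁ 1out
live3142-step 4inD-13inI (pushD (s≤s (s≤s ())))
live3142-step 4inD-13inI (moveDI (s≤s ()))
live3142-step 4inD-13inI popI                           = inj₁ 4inD-1out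
live3142-step 1out       (pushD _)                      = inj₁ 4inD-1out
live3142-step 1out       popI                           = inj₂ λ _ ()
live3142-step 4inD-1out  (pushD (s≤s (s≤s ())))
live3142-step 4inD-1out  (moveDI (s≤s (s≤s (s≤s ()))))
live3142-step 4inD-1out  popI                           = inj₂ λ _ ()

-- Live configurations for π = 3241.  The final 1 can only be pushed on an
-- empty D, but 3 must wait in I (it may not precede 2), so 4 is stuck on D.
data Live3241 : Config → Set where
  start      : Live3241 (3 ∷ 2 ∷ 4 ∷ 1 ∷ [] , [] , [] , [])
  3inD       : Live3241 (2 ∷ 4 ∷ 1 ∷ [] , 3 ∷ [] , [] , [])
  3inI       : Live3241 (2 ∷ 4 ∷ 1 ∷ [] , [] , 3 ∷ [] , [])
  2inD       : Live3241 (4 ∷ 1 ∷ [] , 2 ∷ [] , 3 ∷ [] , [])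
  42inD      : Live3241 (1 ∷ [] , 4 ∷ 2 ∷ [] , 3 ∷ [] , [])
  23inI      : Live3241 (4 ∷ 1 ∷ [] , [] , 2 ∷ 3 ∷ [] , [])
  4inD-23inI : Live3241 (1 ∷ [] , 4 ∷ [] , 2 ∷ 3 ∷ [] , [])

live3241-step : ∀ {c c'} → Live3241 c → Step c c' → Live3241 c' ⊎ OutputDiverges (identity 4) c'
live3241-step start      (pushD _)                      = inj₁ 3inD
live3241-step 3inD       (pushD (s≤s (s≤s ())))
live3241-step 3inD       (moveDI _)                     = inj₁ 3inI
live3241-step 3inI       (pushD _)                      = inj₁ 2inD
live3241-step 3inI       popI                           = inj₂ λ _ ()
live3241-step 2inD       (pushD _)                      = inj₁ 42inD
live3241-step 2inD       (moveDI _)                     = inj₁ 23inI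
live3241-step 2inD       popI                           = inj₂ λ _ ()
live3241-step 42inD      (pushD (s≤s ()))
live3241-step 42inD      (moveDI (s≤s (s≤s (s≤s ()))))
live3241-step 42inD      popI                           = inj₂ λ _ ()
live3241-step 23inI      (pushD _)                      = inj₁ 4inD-23inI
live3241-step 23inI      popI                           = inj₂ λ _ ()
live3241-step 4inD-23inI (pushD (s≤s ()))
live3241-step 4inD-23inI (moveDI (s≤s (s≤s ())))
live3241-step 4inD-23inI popI                           = inj₂ λ _ ()

proposition1 : (¬ DISortable 4 (3 ∷ 1 ∷ 4 ∷ 2 ∷ [])) × (¬ DISortable 4 (3 ∷ 2 ∷ 4 ∷ 1 ∷ []))
proposition1 =
    unreachable (sorted 4) Live3142 live3142-step (λ ()) start
  , unreachable (sorted 4) Live3241 live3241-step (λ ()) start
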